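{- Let $t, q \geq 0$ be integers, let $P^{(1)}, \ldots, P^{(t)}$ be paths and $C^{(1)}, \ldots, C^{(q)}$ be cycles, all pairwise vertex-disjoint, such that $l(C^{(j)}) \geq 5$ for each $j = 1, \ldots, q$ and $l(P^{(i)}) \geq 1$ for each $i = 1, \ldots, t$. Let $G = \left(\sum_{i=1}^{t} P^{(i)}\right) + \left(\sum_{j=1}^{q} C^{(j)}\right)$ be their disjoint union. Suppose further that if $q = 0$ and $t = 1$, then $l(P^{(1)}) \geq 3$. Then there exists a special permutation of $V(G)$, i.e. a bijection $\sigma: V(G) \to V(G)$ such that for every edge $xy$ of $G$, the vertices $\sigma(x)$ and $\sigma(y)$ are distinct and non-adjacent in $G$.
   Context: Graphs are finite and simple. The length $l(P)$ of a path $P$ and the length $l(C)$ of a cycle $C$ is its number of edges. $G_1 + G_2$ (and $\sum$) denotes disjoint union of graphs. For a graph $G$, a permutation $\sigma$ of $V(G)$ is called a special permutation of $V(G)$ if for every edge $xy \in E(G)$, $\sigma(x)\sigma(y)$ is an edge of the complement $\overline{G}$ of $G$ (equivalently, $\sigma(x)$ and $\sigma(y)$ are non-adjacent in $G$). -}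

module Defs where

open import Level using (0ℓ)
open import Data.Nat using (ℕ; zero; suc; _+_; _≤_; _%_)
open import Data.Fin using (Fin; toℕ; splitAt)
open import Data.Sum using (_⊎_; inj₁; inj₂)
open import Data.Empty using (⊥)
open import Data.List using (List; []; _∷_; length)
open import Data.List.Relation.Unary.All using (All)
open import Data.Product using (_×_)
open import Relation.Binary.PropositionalEquality using (_≡_; _≢_)
open import Relation.Nullary using (¬_)
open import Function.Bundles using (_↔_; Inverse)
open import Function.Base using (_on_)

record Graph : Set₁ where
  field
    order : ℕ
    Adj   : Fin order → Fin order → Set
    sym   : ∀ {x y} → Adj x y → Adj y x
    irrefl : ∀ {x} → ¬ Adj x x

open Graph public

emptyGraph : Graph
emptyGraph = record { order = 0 ; Adj = λ () ; sym = λ { {()} } ; irrefl = λ { {()} } }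

UAdj : (G₁ G₂ : Graph) → (Fin (order G₁) ⊎ Fin (order G₂)) → (Fin (order G₁) ⊎ Fin (order G₂)) → Set
UAdj G₁ G₂ (inj₁ x) (inj₁ y) = Adj G₁ x y
UAdj G₁ G₂ (inj₂ x) (inj₂ y) = Adj G₂ x y
UAdj G₁ G₂ (inj₁ x) (inj₂ y) = ⊥
UAdj G₁ G₂ (inj₂ x) (inj₁ y) = ⊥

USym : (G₁ G₂ : Graph) → ∀ u v → UAdj G₁ G₂ u v → UAdj G₁ G₂ v u
USym G₁ G₂ (inj₁ x) (inj₁ y) a = sym G₁ a
USym G₁ G₂ (inj₂ x) (inj₂ y) a = sym G₂ a

UIrr : (G₁ G₂ : Graph) → ∀ u → ¬ UAdj G₁ G₂ u u
UIrr G₁ G₂ (inj₁ x) = irrefl G₁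
UIrr G₁ G₂ (inj₂ x) = irrefl G₂

_⊕_ : Graph → Graph → Graph
G₁ ⊕ G₂ = record
  { order = order G₁ + order G₂
  ; Adj = λ x y → UAdj G₁ G₂ (splitAt (order G₁) x) (splitAt (order G₁) y)
  ; sym = λ {x} {y} → USym G₁ G₂ (splitAt (order G₁) x) (splitAt (order G₁) y)
  ; irrefl = λ {x} → UIrr G₁ G₂ (splitAt (order G₁) x)
  }

-- Path of length l (l edges): vertices 0..l, i ~ j iff |i - j| = 1.
PathAdj : ∀ l → Fin (suc l) → Fin (suc l) → Set
PathAdj l i j = (toℕ j ≡ suc (toℕ i)) ⊎ (toℕ i ≡ suc (toℕ j))

-- Cycle of length m = l + 3 (m edges, m ≥ 3): vertices 0..m-1, consecutive
-- vertices adjacent, plus the closing edge between 0 and m-1.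
CycleAdj : ∀ l → Fin (suc (suc (suc l))) → Fin (suc (suc (suc l))) → Set
CycleAdj l i j = ((toℕ j ≡ suc (toℕ i)) ⊎ (toℕ i ≡ suc (toℕ j)))
               ⊎ ((toℕ i ≡ 0 × toℕ j ≡ suc (suc l)) ⊎ (toℕ j ≡ 0 × toℕ i ≡ suc (suc l)))

open import Data.Nat.Properties using (1+n≢n)
open import Relation.Binary.PropositionalEquality using (refl; trans) renaming (sym to ≡-sym)
open import Data.Sum using (swap; map)
open import Data.Product using (_,_; proj₁; proj₂)

pathIrr : ∀ l {i} → ¬ PathAdj l i i
pathIrr l {i} (inj₁ e) = 1+n≢n (≡-sym e)
pathIrr l {i} (inj₂ e) = 1+n≢n (≡-sym e)

path : ℕ → Graph
path l = record { order = suc l ; Adj = PathAdj l ; sym = swap ; irrefl = pathIrr l }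

cycleIrr : ∀ l {i} → ¬ CycleAdj l i i
cycleIrr l (inj₁ (inj₁ e)) = 1+n≢n (≡-sym e)
cycleIrr l (inj₁ (inj₂ e)) = 1+n≢n (≡-sym e)
cycleIrr l (inj₂ (inj₁ (a , b))) with trans (≡-sym a) b
... | ()
cycleIrr l (inj₂ (inj₂ (a , b))) with trans (≡-sym a) b
... | ()

cycle : ℕ → Graph
cycle l = record { order = suc (suc (suc l)) ; Adj = CycleAdj l
                 ; sym = map swap swap ; irrefl = cycleIrr l }

⨁ : List Graph → Graph
⨁ [] = emptyGraph
⨁ (G ∷ Gs) = G ⊕ ⨁ Gs

record SpecialPermutation (G : Graph) : Set where
  field
    σ       : Fin (order G) ↔ Fin (order G)
    special : ∀ x y → Adj G x y →
              (Inverse.to σ x ≢ Inverse.to σ y) × ¬ Adj G (Inverse.to σ x) (Inverse.to σ y)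

{-# OPTIONS --safe #-}
module Submission where

-- Special permutations of two graphs combine into one of their disjoint union, and a
-- special permutation of H is one of every spanning subgraph of H (up to relabelling).
-- The vertices of a cycle of length n ≥ 5 can be listed as 1, 3, 5, …, 0, 2, 4, … (for
-- even n with 0 and 2 exchanged) so that cyclically consecutive entries are non-adjacent;
-- sending the i-th vertex to the i-th entry is special. A path of length l ≥ 4 spans the
-- cycle of length l + 1, the path of length 3 is done by hand, and several paths are
-- joined end to end into a single path of length ≥ 3. What remains is one path of
-- length 1 or 2 beside a non-empty union of cycles with special permutation τ. Its vertex
-- c = 1 lies on every edge, so exchanging it with a vertex z of the cycles (c ↦ τ z,
-- z ↦ c), keeping the other path vertices and applying τ to the other cycle vertices is
-- special.

open import Defs hiding (sym)
open import Level using (0ℓ)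
open import Data.Nat
  using (ℕ; zero; suc; _+_; _≤_; _<_; _∸_; z≤n; s≤s; s≤s⁻¹; _≤?_; _<?_)
open import Data.Nat.Properties
  using (suc-injective; +-suc; +-identityʳ; m+n∸m≡n; m+n≮m; m≤n⇒∃[o]m+o≡n; ≮⇒≥; ≤∧≢⇒<;
         ≰⇒>; ≤-refl; ≤-trans; n≤1+n; n<1+n; m≤m+n; +-mono-≤; +-cancelˡ-<; 1+n≢n;
         m≢1+n+m; 1+n≰n)
  renaming (_≟_ to _≟ℕ_)
open import Data.Fin using (Fin; zero; suc; toℕ; fromℕ<; splitAt; join; _≟_; punchOut)
open import Data.Fin.Properties
  using (+↔⊎; splitAt-join; toℕ-↑ˡ; toℕ-↑ʳ; toℕ-fromℕ<; toℕ<n; toℕ-injective;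
         all?; any?; punchOut-injective; injective⇒≤)
open import Data.Sum using (_⊎_; inj₁; inj₂; [_,_])
import Data.Sum as Sum
open import Data.Sum.Algebra using (⊎-assoc)
open import Data.Sum.Function.Propositional using (_⊎-↔_)
open import Data.Sum.Relation.Binary.Pointwise using (Pointwise; inj₁; inj₂)
open import Data.Product using (∃; _×_; _,_; proj₁; proj₂)
open import Data.Unit using (tt)
open import Data.List using (List; []; _∷_; map; _++_)
open import Data.List.Relation.Unary.All using (All; []; _∷_)
import Data.List.Relation.Unary.All as All
open import Data.List.Relation.Unary.All.Properties using (map⁺)
open import Function.Base using (_∘_; id)
open import Function.Bundles using (_↔_; Inverse; Injection; mk↔ₛ′)
open import Function.Definitions using (Injective)
open import Function.Properties.Inverse using (↔-refl; ↔-sym; ↔-trans; ↔⇒↣)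
open import Relation.Binary.Core using (Rel)
open import Relation.Binary.Definitions using (DecidableEquality)
open import Relation.Binary.PropositionalEquality
  using (_≡_; _≢_; refl; sym; trans; cong; subst; subst₂; module ≡-Reasoning)
open import Relation.Nullary using (¬_; Dec; yes; no; contradiction)
open import Relation.Nullary.Decidable using (toWitness; _⊎-dec_; _→-dec_; ¬?)

open Inverse using (to; strictlyInverseˡ)

private
  variable
    A B C : Set
    R R′ : Rel A 0ℓ
    S S′ : Rel B 0ℓ
    T : Rel C 0ℓ
    G G′ H H′ K : Graph

-- Self-packings and spanning subgraphs

-- The paper's special permutation without the distinctness condition, which follows
-- from irreflexivity; unlike SpecialPermutation it makes sense on any vertex type.
record SelfPacking (R : Rel A 0ℓ) : Set where
  field
    σ         : A ↔ A
    separates : ∀ {x y} → R x y → ¬ R (to σ x) (to σ y)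

record _≼_ (R : Rel A 0ℓ) (S : Rel B 0ℓ) : Set where
  field
    relabel   : A ↔ B
    preserves : ∀ {x y} → R x y → S (to relabel x) (to relabel y)

≼-refl : R ≼ R
≼-refl = record { relabel = ↔-refl ; preserves = id }

≼-trans : R ≼ S → S ≼ T → R ≼ T
≼-trans φ ψ = record
  { relabel   = ↔-trans (relabel φ) (relabel ψ)
  ; preserves = preserves ψ ∘ preserves φ
  }
  where open _≼_

selfPacking-antimono : R ≼ S → SelfPacking S → SelfPacking R
selfPacking-antimono {S = S} φ τ = record
  { σ         = ↔-trans relabel (↔-trans σ (↔-sym relabel))
  ; separates = λ r r′ → separates (preserves r)
      (subst₂ S (strictlyInverseˡ relabel _) (strictlyInverseˡ relabel _) (preserves r′))
  }
  where
  open _≼_ φ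
  open SelfPacking τ

injective⇒surjective : ∀ {n} {f : Fin n → Fin n} → Injective _≡_ _≡_ f →
                       ∀ y → ∃ λ x → f x ≡ y
injective⇒surjective {suc n} {f} f-injective y with any? (λ x → f x ≟ y)
... | yes found = found
... | no  missed = contradiction (injective⇒≤ f-avoiding-y-injective) 1+n≰n
  where
  y≢f : ∀ x → y ≢ f x
  y≢f x y≡fx = missed (x , sym y≡fx)
  f-avoiding-y : Fin (suc n) → Fin n
  f-avoiding-y x = punchOut (y≢f x)
  f-avoiding-y-injective : Injective _≡_ _≡_ f-avoiding-y
  f-avoiding-y-injective = f-injective ∘ punchOut-injective (y≢f _) (y≢f _)

selfPacking-fromInjection : ∀ {n} {R : Rel (Fin n) 0ℓ} (f : Fin n → Fin n) →
                            Injective _≡_ _≡_ f → (∀ {x y} → R x y → ¬ R (f x) (f y)) →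
                            SelfPacking R
selfPacking-fromInjection f f-injective f-separates = record
  { σ         = mk↔ₛ′ f (proj₁ ∘ preimage) (proj₂ ∘ preimage)
                  (λ x → f-injective (proj₂ (preimage (f x))))
  ; separates = f-separates
  }
  where
  preimage : ∀ y → ∃ λ x → f x ≡ y
  preimage = injective⇒surjective f-injective

-- Disjoint unions

⊎-selfPacking : SelfPacking R → SelfPacking S → SelfPacking (Pointwise R S)
⊎-selfPacking ρ τ = record
  { σ         = SelfPacking.σ ρ ⊎-↔ SelfPacking.σ τ
  ; separates = λ { (inj₁ r) (inj₁ r′) → SelfPacking.separates ρ r r′
                  ; (inj₂ s) (inj₂ s′) → SelfPacking.separates τ s s′ }
  }

⊎-mono-≼ : R ≼ R′ → S ≼ S′ → Pointwise R S ≼ Pointwise R′ S′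
⊎-mono-≼ φ ψ = record
  { relabel   = relabel φ ⊎-↔ relabel ψ
  ; preserves = λ { (inj₁ r) → inj₁ (preserves φ r) ; (inj₂ s) → inj₂ (preserves ψ s) }
  }
  where open _≼_

⊎-assoc-≼ : Pointwise R (Pointwise S T) ≼ Pointwise (Pointwise R S) T
⊎-assoc-≼ = record
  { relabel   = ↔-sym (⊎-assoc 0ℓ _ _ _)
  ; preserves = λ { (inj₁ r) → inj₁ (inj₁ r) ; (inj₂ (inj₁ s)) → inj₁ (inj₂ s)
                  ; (inj₂ (inj₂ t)) → inj₂ t }
  }

UAdj⇒Pointwise : ∀ u v → UAdj G H u v → Pointwise (Adj G) (Adj H) u v
UAdj⇒Pointwise (inj₁ x) (inj₁ y) a = inj₁ a
UAdj⇒Pointwise (inj₂ x) (inj₂ y) a = inj₂ a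

Pointwise⇒UAdj : ∀ {u v} → Pointwise (Adj G) (Adj H) u v → UAdj G H u v
Pointwise⇒UAdj (inj₁ a) = a
Pointwise⇒UAdj (inj₂ a) = a

⊕-≼-⊎ : Adj (G ⊕ H) ≼ Pointwise (Adj G) (Adj H)
⊕-≼-⊎ {G} = record
  { relabel   = +↔⊎
  ; preserves = λ {x} {y} → UAdj⇒Pointwise (splitAt (order G) x) (splitAt (order G) y)
  }

⊎-≼-⊕ : Pointwise (Adj G) (Adj H) ≼ Adj (G ⊕ H)
⊎-≼-⊕ {G} {H} = record
  { relabel   = ↔-sym +↔⊎
  ; preserves = λ {u} {v} a →
      subst₂ (UAdj G H) (sym (splitAt-join _ _ u)) (sym (splitAt-join _ _ v)) (Pointwise⇒UAdj a)
  }

⊕-selfPacking : SelfPacking (Adj G) → SelfPacking (Adj H) → SelfPacking (Adj (G ⊕ H))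
⊕-selfPacking ρ τ = selfPacking-antimono ⊕-≼-⊎ (⊎-selfPacking ρ τ)

⊕-mono-≼ : Adj G ≼ Adj G′ → Adj H ≼ Adj H′ → Adj (G ⊕ H) ≼ Adj (G′ ⊕ H′)
⊕-mono-≼ φ ψ = ≼-trans ⊕-≼-⊎ (≼-trans (⊎-mono-≼ φ ψ) ⊎-≼-⊕)

⊕-assoc-≼ : Adj (G ⊕ (H ⊕ K)) ≼ Adj ((G ⊕ H) ⊕ K)
⊕-assoc-≼ {G} {H} {K} =
  ≼-trans (⊕-≼-⊎ {G})
  (≼-trans (⊎-mono-≼ ≼-refl (⊕-≼-⊎ {H} {K}))
  (≼-trans ⊎-assoc-≼
  (≼-trans (⊎-mono-≼ (⊎-≼-⊕ {G} {H}) ≼-refl)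
           (⊎-≼-⊕ {G ⊕ H} {K}))))

⨁-selfPacking : ∀ {Gs} → All (λ G → SelfPacking (Adj G)) Gs → SelfPacking (Adj (⨁ Gs))
⨁-selfPacking []       = record { σ = ↔-refl ; separates = λ { {()} } }
⨁-selfPacking (ρ ∷ ρs) = ⊕-selfPacking ρ (⨁-selfPacking ρs)

selfPacking⇒specialPermutation : SelfPacking (Adj G) → SpecialPermutation G
selfPacking⇒specialPermutation {G} ρ = record
  { σ       = σ
  ; special = λ x y a →
      (λ e → irrefl G (subst (Adj G x) (sym (Injection.injective (↔⇒↣ σ) e)) a)) , separates a
  }
  where open SelfPacking ρ

module _ {A B : Set} (_≟ᴬ_ : DecidableEquality A) (_≟ᴮ_ : DecidableEquality B)
         (a : A) (b : B) where

  exchange : A ⊎ B → A ⊎ B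
  exchange (inj₁ x) with x ≟ᴬ a
  ... | yes _ = inj₂ b
  ... | no  _ = inj₁ x
  exchange (inj₂ y) with y ≟ᴮ b
  ... | yes _ = inj₁ a
  ... | no  _ = inj₂ y

  exchange-involutive : ∀ u → exchange (exchange u) ≡ u
  exchange-involutive (inj₁ x) with x ≟ᴬ a
  exchange-involutive (inj₁ x) | yes refl with b ≟ᴮ b
  ... | yes _   = refl
  ... | no  b≢b = contradiction refl b≢b
  exchange-involutive (inj₁ x) | no x≢a with x ≟ᴬ a
  ... | yes x≡a = contradiction x≡a x≢a
  ... | no  _   = refl
  exchange-involutive (inj₂ y) with y ≟ᴮ b
  exchange-involutive (inj₂ y) | yes refl with a ≟ᴬ a
  ... | yes _   = refl
  ... | no  a≢a = contradiction refl a≢a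
  exchange-involutive (inj₂ y) | no y≢b with y ≟ᴮ b
  ... | yes y≡b = contradiction y≡b y≢b
  ... | no  _   = refl

  exchange-↔ : (A ⊎ B) ↔ (A ⊎ B)
  exchange-↔ = mk↔ₛ′ exchange exchange exchange-involutive exchange-involutive

star⊕-selfPacking : ∀ (c : Fin (order G)) → (∀ {x y} → Adj G x y → x ≡ c ⊎ y ≡ c) →
                    SelfPacking (Adj H) → Fin (order H) → SelfPacking (Adj (G ⊕ H))
star⊕-selfPacking {G} {H} c star τ z = selfPacking-antimono (⊕-≼-⊎ {G} {H}) (record
  { σ         = ↔-trans (↔-refl ⊎-↔ σ) (exchange-↔ _≟_ _≟_ c (to σ z))
  ; separates = separates′
  })
  where
  open SelfPacking τ
  ex : Fin (order G) ⊎ Fin (order H) → Fin (order G) ⊎ Fin (order H)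
  ex = exchange _≟_ _≟_ c (to σ z)
  separates′ : ∀ {u v} → Pointwise (Adj G) (Adj H) u v →
               ¬ Pointwise (Adj G) (Adj H) (ex (Sum.map id (to σ) u)) (ex (Sum.map id (to σ) v))
  separates′ (inj₁ {x} {y} a) with x ≟ c | y ≟ c
  ... | yes refl | yes refl = λ _ → irrefl G a
  ... | yes _    | no  _    = λ ()
  ... | no  _    | yes _    = λ ()
  ... | no  x≢c  | no  y≢c  = λ _ → [ x≢c , y≢c ] (star a)
  separates′ (inj₂ {x} {y} a) with to σ x ≟ to σ z | to σ y ≟ to σ z
  ... | yes _ | yes _ = λ { (inj₁ c∼c) → irrefl G c∼c }
  ... | yes _ | no  _ = λ ()
  ... | no  _ | yes _ = λ ()
  ... | no  _ | no  _ = λ { (inj₂ a′) → separates a a′ }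

-- Cycles

-- PathAdj l i j and CycleAdj k i j unfold to Consecutive (toℕ i) (toℕ j) and
-- CycleAdjℕ k (toℕ i) (toℕ j).
Consecutive : ℕ → ℕ → Set
Consecutive a b = b ≡ suc a ⊎ a ≡ suc b

CycleAdjℕ : ℕ → ℕ → ℕ → Set
CycleAdjℕ k a b =
  Consecutive a b ⊎ ((a ≡ 0 × b ≡ suc (suc k)) ⊎ (b ≡ 0 × a ≡ suc (suc k)))

CycleAdjℕ-sym : ∀ {k a b} → CycleAdjℕ k a b → CycleAdjℕ k b a
CycleAdjℕ-sym = Sum.map Sum.swap Sum.swap

cycle-selfPacking-fromListing :
  ∀ k (f : ℕ → ℕ) → (∀ {i} → i < 3 + k → f i < 3 + k) → Injective _≡_ _≡_ f →
  (∀ i → ¬ CycleAdjℕ k (f i) (f (suc i))) → ¬ CycleAdjℕ k (f 0) (f (2 + k)) →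
  SelfPacking (Adj (cycle k))
cycle-selfPacking-fromListing k f f-bounded f-injective step close =
  selfPacking-fromInjection f̂ f̂-injective f̂-separates
  where
  f̂ : Fin (3 + k) → Fin (3 + k)
  f̂ x = fromℕ< (f-bounded (toℕ<n x))
  toℕ-f̂ : ∀ x → toℕ (f̂ x) ≡ f (toℕ x)
  toℕ-f̂ x = toℕ-fromℕ< _
  f̂-injective : Injective _≡_ _≡_ f̂
  f̂-injective {x} {y} e =
    toℕ-injective (f-injective (trans (sym (toℕ-f̂ x)) (trans (cong toℕ e) (toℕ-f̂ y))))
  separated : ∀ {a b} → CycleAdjℕ k a b → ¬ CycleAdjℕ k (f a) (f b)
  separated (inj₁ (inj₁ refl))          = step _
  separated (inj₁ (inj₂ refl))          = step _ ∘ CycleAdjℕ-sym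
  separated (inj₂ (inj₁ (refl , refl))) = close
  separated (inj₂ (inj₂ (refl , refl))) = close ∘ CycleAdjℕ-sym
  f̂-separates : ∀ {x y} → CycleAdj k x y → ¬ CycleAdj k (f̂ x) (f̂ y)
  f̂-separates {x} {y} adj = separated adj ∘ subst₂ (CycleAdjℕ k) (toℕ-f̂ x) (toℕ-f̂ y)

double-suc : ∀ m → suc m + suc m ≡ 2 + (m + m)
double-suc m = cong suc (+-suc m m)

double-+ : ∀ n m → (n + m) + (n + m) ≡ (n + n) + (m + m)
double-+ zero    m = refl
double-+ (suc n) m = begin
  suc (n + m) + suc (n + m)   ≡⟨ double-suc (n + m) ⟩
  2 + ((n + m) + (n + m))     ≡⟨ cong (2 +_) (double-+ n m) ⟩
  2 + ((n + n) + (m + m))     ≡⟨ cong (_+ (m + m)) (double-suc n) ⟨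
  (suc n + suc n) + (m + m)   ∎
  where open ≡-Reasoning

double-injective : ∀ {m n} → m + m ≡ n + n → m ≡ n
double-injective {zero}  {zero}  _ = refl
double-injective {suc m} {suc n} e =
  cong suc (double-injective (suc-injective (suc-injective
    (trans (sym (double-suc m)) (trans e (double-suc n))))))

odd≢even : ∀ m n → suc (m + m) ≢ n + n
odd≢even zero    (suc n) e with trans e (double-suc n)
... | ()
odd≢even (suc m) (suc n) e = odd≢even m n (suc-injective (suc-injective
  (trans (cong suc (sym (double-suc m))) (trans e (double-suc n)))))

oddsThenEvens : ℕ → ℕ → ℕ
oddsThenEvens h i with i <? h
... | yes _ = suc (i + i)
... | no  _ = (i ∸ h) + (i ∸ h)

data OddsOrEvens (h : ℕ) : ℕ → Set where
  odds  : ∀ {i} → i < h → OddsOrEvens h i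
  evens : ∀ j → OddsOrEvens h (h + j)

oddsOrEvens : ∀ h i → OddsOrEvens h i
oddsOrEvens h i with i <? h
... | yes i<h = odds i<h
... | no  i≮h with j , refl ← m≤n⇒∃[o]m+o≡n (≮⇒≥ i≮h) = evens j

oddsThenEvens-odd : ∀ {h i} → i < h → oddsThenEvens h i ≡ suc (i + i)
oddsThenEvens-odd {h} {i} i<h with i <? h
... | yes _   = refl
... | no  i≮h = contradiction i<h i≮h

oddsThenEvens-even : ∀ h j → oddsThenEvens h (h + j) ≡ j + j
oddsThenEvens-even h j with h + j <? h
... | yes h+j<h = contradiction h+j<h (m+n≮m h j)
... | no  _     = cong (λ i → i + i) (m+n∸m≡n h j)

oddsThenEvens-self : ∀ h → oddsThenEvens h h ≡ 0
oddsThenEvens-self h = trans (cong (oddsThenEvens h) (sym (+-identityʳ h))) (oddsThenEvens-even h 0)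

oddsThenEvens-suc : ∀ h {i} → suc i ≢ h → oddsThenEvens h (suc i) ≡ 2 + oddsThenEvens h i
oddsThenEvens-suc h {i} i+1≢h with oddsOrEvens h i
... | odds i<h = begin
  oddsThenEvens h (suc i) ≡⟨ oddsThenEvens-odd (≤∧≢⇒< i<h i+1≢h) ⟩
  suc (suc (i + suc i))   ≡⟨ cong (2 +_) (+-suc i i) ⟩
  2 + suc (i + i)         ≡⟨ cong (2 +_) (oddsThenEvens-odd i<h) ⟨
  2 + oddsThenEvens h i   ∎
  where open ≡-Reasoning
... | evens j = begin
  oddsThenEvens h (suc (h + j)) ≡⟨ cong (oddsThenEvens h) (+-suc h j) ⟨
  oddsThenEvens h (h + suc j)   ≡⟨ oddsThenEvens-even h (suc j) ⟩
  suc (j + suc j)               ≡⟨ cong suc (+-suc j j) ⟩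
  2 + (j + j)                   ≡⟨ cong (2 +_) (oddsThenEvens-even h j) ⟨
  2 + oddsThenEvens h (h + j)   ∎
  where open ≡-Reasoning

oddsThenEvens-injective : ∀ h → Injective _≡_ _≡_ (oddsThenEvens h)
oddsThenEvens-injective h {i} {i′} e with oddsOrEvens h i | oddsOrEvens h i′
... | odds i<h | odds i′<h rewrite oddsThenEvens-odd i<h | oddsThenEvens-odd i′<h =
  double-injective (suc-injective e)
... | odds i<h | evens j rewrite oddsThenEvens-odd i<h | oddsThenEvens-even h j =
  contradiction e (odd≢even i j)
... | evens j | odds i′<h rewrite oddsThenEvens-even h j | oddsThenEvens-odd i′<h =
  contradiction (sym e) (odd≢even i′ j)
... | evens j | evens j′ rewrite oddsThenEvens-even h j | oddsThenEvens-even h j′ =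
  cong (h +_) (double-injective e)

oddsThenEvens-bounded : ∀ {h m i} → h ≤ m → m ≤ suc h → i < h + m → oddsThenEvens h i < h + m
oddsThenEvens-bounded {h} {m} {i} h≤m m≤1+h i<h+m with oddsOrEvens h i
... | odds i<h rewrite oddsThenEvens-odd i<h =
  subst (_≤ h + m) (cong suc (+-suc i i)) (+-mono-≤ i<h (≤-trans i<h h≤m))
... | evens j rewrite oddsThenEvens-even h j =
  subst (_≤ h + m) (+-suc j j) (+-mono-≤ (s≤s⁻¹ (≤-trans j<m m≤1+h)) j<m)
  where
  j<m : j < m
  j<m = +-cancelˡ-< h j m i<h+m

nonadjacent-2+ : ∀ {k} a → ¬ CycleAdjℕ (suc k) a (2 + a)
nonadjacent-2+ a (inj₁ (inj₁ e))          = 1+n≢n e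
nonadjacent-2+ a (inj₁ (inj₂ e))          = m≢1+n+m a e
nonadjacent-2+ a (inj₂ (inj₁ (refl , ())))
nonadjacent-2+ a (inj₂ (inj₂ (() , _)))

oddCycle-selfPacking : ∀ k h → h + h ≡ 3 + k → SelfPacking (Adj (cycle (suc k)))
oddCycle-selfPacking k (suc h) 2h+2≡3+k =
  cycle-selfPacking-fromListing (suc k) F bounded (oddsThenEvens-injective (suc h)) step close
  where
  F : ℕ → ℕ
  F = oddsThenEvens (suc h)
  2h+1≡2+k : suc (h + h) ≡ 2 + k
  2h+1≡2+k = suc-injective (trans (sym (double-suc h)) 2h+2≡3+k)
  n≡4+k : suc h + suc (suc h) ≡ 4 + k
  n≡4+k = trans (+-suc (suc h) (suc h)) (cong suc 2h+2≡3+k)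
  bounded : ∀ {i} → i < 4 + k → F i < 4 + k
  bounded {i} i<n = subst (F i <_) n≡4+k
    (oddsThenEvens-bounded {suc h} (n≤1+n (suc h)) ≤-refl (subst (i <_) (sym n≡4+k) i<n))
  junction : ¬ CycleAdjℕ (suc k) (2 + k) 0
  junction (inj₁ (inj₁ ()))
  junction (inj₁ (inj₂ ()))
  junction (inj₂ (inj₁ (() , _)))
  junction (inj₂ (inj₂ (_ , e))) = 1+n≢n (sym e)
  step : ∀ i → ¬ CycleAdjℕ (suc k) (F i) (F (suc i))
  step i with suc i ≟ℕ suc h
  ... | no  i+1≢h rewrite oddsThenEvens-suc (suc h) i+1≢h = nonadjacent-2+ (F i)
  ... | yes refl =
    junction ∘ subst₂ (CycleAdjℕ (suc k)) (trans (oddsThenEvens-odd (n<1+n h)) 2h+1≡2+k)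
                                          (oddsThenEvens-self (suc h))
  last : ¬ CycleAdjℕ (suc k) 1 (3 + k)
  last (inj₁ (inj₁ ()))
  last (inj₁ (inj₂ ()))
  last (inj₂ (inj₁ (() , _)))
  last (inj₂ (inj₂ (() , _)))
  F-last : F (3 + k) ≡ 3 + k
  F-last = begin
    F (3 + k)         ≡⟨ cong F 2h+2≡3+k ⟨
    F (suc h + suc h) ≡⟨ oddsThenEvens-even (suc h) (suc h) ⟩
    suc h + suc h     ≡⟨ 2h+2≡3+k ⟩
    3 + k             ∎
    where open ≡-Reasoning
  close : ¬ CycleAdjℕ (suc k) (F 0) (F (3 + k))
  close = last ∘ subst₂ (CycleAdjℕ (suc k)) (oddsThenEvens-odd {suc h} (s≤s z≤n)) F-last

swap02 : ℕ → ℕ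
swap02 0 = 2
swap02 2 = 0
swap02 a = a

swap02-involutive : ∀ a → swap02 (swap02 a) ≡ a
swap02-involutive 0                   = refl
swap02-involutive 1                   = refl
swap02-involutive 2                   = refl
swap02-involutive (suc (suc (suc a))) = refl

swap02-bounded : ∀ {n a} → 2 < n → a < n → swap02 a < n
swap02-bounded {a = 0}                 2<n _   = 2<n
swap02-bounded {a = 1}                 _   1<n = 1<n
swap02-bounded {a = 2}                 2<n _   = ≤-trans (s≤s z≤n) 2<n
swap02-bounded {a = suc (suc (suc a))} _   a<n = a<n

-- Exchanging 0 and 2 repairs the junction 2h − 1, 0 of oddsThenEvens h, an edge of the
-- cycle of length 2h.
evenCycle-selfPacking : ∀ k h → h + h ≡ 6 + k → SelfPacking (Adj (cycle (3 + k)))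
evenCycle-selfPacking k (suc h) 2h+2≡6+k =
  cycle-selfPacking-fromListing (3 + k) (swap02 ∘ F) bounded injective step close
  where
  F : ℕ → ℕ
  F = oddsThenEvens (suc h)
  2h+1≡5+k : suc (h + h) ≡ 5 + k
  2h+1≡5+k = suc-injective (trans (sym (double-suc h)) 2h+2≡6+k)
  bounded : ∀ {i} → i < 6 + k → swap02 (F i) < 6 + k
  bounded {i} i<n = swap02-bounded (s≤s (s≤s (s≤s z≤n))) (subst (F i <_) 2h+2≡6+k
    (oddsThenEvens-bounded {suc h} ≤-refl (n≤1+n (suc h)) (subst (i <_) (sym 2h+2≡6+k) i<n)))
  injective : Injective _≡_ _≡_ (swap02 ∘ F)
  injective {i} {j} e = oddsThenEvens-injective (suc h)
    (trans (sym (swap02-involutive (F i))) (trans (cong swap02 e) (swap02-involutive (F j))))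
  nonadjacent-swap02-2+ : ∀ a → ¬ CycleAdjℕ (3 + k) (swap02 a) (swap02 (2 + a))
  nonadjacent-swap02-2+ 0 (inj₁ (inj₁ ()))
  nonadjacent-swap02-2+ 0 (inj₁ (inj₂ ()))
  nonadjacent-swap02-2+ 0 (inj₂ (inj₁ (() , _)))
  nonadjacent-swap02-2+ 0 (inj₂ (inj₂ (_ , ())))
  nonadjacent-swap02-2+ 1 = nonadjacent-2+ 1
  nonadjacent-swap02-2+ 2 (inj₁ (inj₁ ()))
  nonadjacent-swap02-2+ 2 (inj₁ (inj₂ ()))
  nonadjacent-swap02-2+ 2 (inj₂ (inj₁ (_ , ())))
  nonadjacent-swap02-2+ 2 (inj₂ (inj₂ (() , _)))
  nonadjacent-swap02-2+ (suc (suc (suc a))) = nonadjacent-2+ (3 + a)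
  junction : ¬ CycleAdjℕ (3 + k) (5 + k) 2
  junction (inj₁ (inj₁ ()))
  junction (inj₁ (inj₂ ()))
  junction (inj₂ (inj₁ (() , _)))
  junction (inj₂ (inj₂ (() , _)))
  step : ∀ i → ¬ CycleAdjℕ (3 + k) (swap02 (F i)) (swap02 (F (suc i)))
  step i with suc i ≟ℕ suc h
  ... | no  i+1≢h rewrite oddsThenEvens-suc (suc h) i+1≢h = nonadjacent-swap02-2+ (F i)
  ... | yes refl =
    junction ∘ subst₂ (CycleAdjℕ (3 + k))
                 (cong swap02 (trans (oddsThenEvens-odd (n<1+n h)) 2h+1≡5+k))
                 (cong swap02 (oddsThenEvens-self (suc h)))
  last : ¬ CycleAdjℕ (3 + k) 1 (4 + k)
  last (inj₁ (inj₁ ()))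
  last (inj₁ (inj₂ ()))
  last (inj₂ (inj₁ (() , _)))
  last (inj₂ (inj₂ (() , _)))
  F-last : F (5 + k) ≡ 4 + k
  F-last = begin
    F (5 + k)     ≡⟨ cong F 2h+1≡5+k ⟨
    F (suc h + h) ≡⟨ oddsThenEvens-even (suc h) h ⟩
    h + h         ≡⟨ suc-injective 2h+1≡5+k ⟩
    4 + k         ∎
    where open ≡-Reasoning
  close : ¬ CycleAdjℕ (3 + k) (swap02 (F 0)) (swap02 (F (5 + k)))
  close = last ∘ subst₂ (CycleAdjℕ (3 + k))
                        (cong swap02 (oddsThenEvens-odd {suc h} (s≤s z≤n))) (cong swap02 F-last)

data EvenOrOdd : ℕ → Set where
  even : ∀ m → EvenOrOdd (m + m)
  odd  : ∀ m → EvenOrOdd (suc (m + m))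

evenOrOdd : ∀ n → EvenOrOdd n
evenOrOdd zero = even 0
evenOrOdd (suc n) with evenOrOdd n
... | even m = odd m
... | odd  m = subst EvenOrOdd (double-suc m) (even (suc m))

cycle-selfPacking : ∀ k → SelfPacking (Adj (cycle (2 + k)))
cycle-selfPacking k with evenOrOdd k
... | even m = oddCycle-selfPacking (suc (m + m)) (2 + m) (double-+ 2 m)
... | odd  m = evenCycle-selfPacking (m + m) (3 + m) (double-+ 3 m)

cycle∸3-selfPacking : ∀ {c} → 5 ≤ c → SelfPacking (Adj (cycle (c ∸ 3)))
cycle∸3-selfPacking (s≤s (s≤s (s≤s (s≤s (s≤s _))))) = cycle-selfPacking _

-- Paths

PathAdj? : ∀ l i j → Dec (PathAdj l i j)
PathAdj? l i j = (toℕ j ≟ℕ suc (toℕ i)) ⊎-dec (toℕ i ≟ℕ suc (toℕ j))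

path3-selfPacking : SelfPacking (Adj (path 3))
path3-selfPacking = selfPacking-fromInjection f (f-injective _ _) (f-separates _ _)
  where
  f : Fin 4 → Fin 4
  f zero                   = suc zero
  f (suc zero)             = suc (suc (suc zero))
  f (suc (suc zero))       = zero
  f (suc (suc (suc zero))) = suc (suc zero)
  f-injective : ∀ x y → f x ≡ f y → x ≡ y
  f-injective = toWitness {a? = all? λ x → all? λ y → (f x ≟ f y) →-dec (x ≟ y)} tt
  f-separates : ∀ x y → PathAdj 3 x y → ¬ PathAdj 3 (f x) (f y)
  f-separates = toWitness {a? = all? λ x → all? λ y →
    PathAdj? 3 x y →-dec ¬? (PathAdj? 3 (f x) (f y))} tt

path-≼-cycle : ∀ k → Adj (path (2 + k)) ≼ Adj (cycle k)
path-≼-cycle k = record { relabel = ↔-refl ; preserves = inj₁ }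

path-selfPacking : ∀ {l} → 3 ≤ l → SelfPacking (Adj (path l))
path-selfPacking {1} (s≤s ())
path-selfPacking {2} (s≤s (s≤s ()))
path-selfPacking {3} _ = path3-selfPacking
path-selfPacking {suc (suc (suc (suc k)))} _ =
  selfPacking-antimono (path-≼-cycle (2 + k)) (cycle-selfPacking k)

path-centre : ∀ k → k ≤ 1 →
              ∀ {i j} → PathAdj (suc k) i j → i ≡ suc zero ⊎ j ≡ suc zero
path-centre k k≤1 {i} {j} = centre k≤1 i j
  where
  centre? : ∀ k → Dec (∀ i j → PathAdj (suc k) i j → i ≡ suc zero ⊎ j ≡ suc zero)
  centre? k = all? λ i → all? λ j →
    PathAdj? (suc k) i j →-dec ((i ≟ suc zero) ⊎-dec (j ≟ suc zero))
  centre : k ≤ 1 → ∀ i j → PathAdj (suc k) i j → i ≡ suc zero ⊎ j ≡ suc zero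
  centre z≤n       = toWitness {a? = centre? 0} tt
  centre (s≤s z≤n) = toWitness {a? = centre? 1} tt

path⊕-selfPacking : ∀ {l} → 1 ≤ l → SelfPacking (Adj H) → 3 ≤ l ⊎ Fin (order H) →
                    SelfPacking (Adj (path l ⊕ H))
path⊕-selfPacking _ τ (inj₁ 3≤l) = ⊕-selfPacking (path-selfPacking 3≤l) τ
path⊕-selfPacking {H} {suc k} _ τ (inj₂ z) with k ≤? 1
... | yes k≤1 = star⊕-selfPacking {path (suc k)} {H} (suc zero) (path-centre k k≤1) τ z
... | no  k≰1 = ⊕-selfPacking (path-selfPacking (s≤s (≰⇒> k≰1))) τ

Consecutive-+ : ∀ n {a b} → Consecutive a b → Consecutive (n + a) (n + b)
Consecutive-+ n {a} {b} =
  Sum.map (λ e → trans (cong (n +_) e) (+-suc n a)) (λ e → trans (cong (n +_) e) (+-suc n b))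

path⊕path-≼ : ∀ p q → Adj (path p ⊕ path q) ≼ Adj (path (p + suc q))
path⊕path-≼ p q =
  ≼-trans (⊕-≼-⊎ {path p} {path q}) (record { relabel = ↔-sym +↔⊎ ; preserves = joined })
  where
  joined : ∀ {u v} → Pointwise (PathAdj p) (PathAdj q) u v →
           PathAdj (p + suc q) (join (suc p) (suc q) u) (join (suc p) (suc q) v)
  joined (inj₁ {i} {j} a) =
    subst₂ Consecutive (sym (toℕ-↑ˡ i (suc q))) (sym (toℕ-↑ˡ j (suc q))) a
  joined (inj₂ {i} {j} a) =
    subst₂ Consecutive (sym (toℕ-↑ʳ (suc p) i)) (sym (toℕ-↑ʳ (suc p) j)) (Consecutive-+ (suc p) a)

joinedLength : ℕ → List ℕ → ℕ
joinedLength p []       = p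
joinedLength p (q ∷ qs) = p + suc (joinedLength q qs)

≤-joinedLength : ∀ p ps → p ≤ joinedLength p ps
≤-joinedLength p []      = ≤-refl
≤-joinedLength p (_ ∷ _) = m≤m+n p _

paths-≼-joinedPath : ∀ p ps Gs →
  Adj (⨁ (map path (p ∷ ps) ++ Gs)) ≼ Adj (path (joinedLength p ps) ⊕ ⨁ Gs)
paths-≼-joinedPath p []       Gs = ≼-refl
paths-≼-joinedPath p (q ∷ qs) Gs =
  ≼-trans (⊕-mono-≼ {path p} ≼-refl (paths-≼-joinedPath q qs Gs))
    (≼-trans (⊕-assoc-≼ {path p}) (⊕-mono-≼ (path⊕path-≼ p (joinedLength q qs)) ≼-refl))

cycles : List ℕ → List Graph
cycles = map (λ c → cycle (c ∸ 3))

cycles-selfPacking : ∀ {cs} → All (5 ≤_) cs → SelfPacking (Adj (⨁ (cycles cs)))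
cycles-selfPacking 5≤cs = ⨁-selfPacking (map⁺ (All.map cycle∸3-selfPacking 5≤cs))

lemma6 : (ps cs : List ℕ) →
         All (1 ≤_) ps →
         All (5 ≤_) cs →
         (∀ p → cs ≡ [] → ps ≡ p ∷ [] → 3 ≤ p) →
         SpecialPermutation (⨁ (map path ps ++ map (λ c → cycle (c ∸ 3)) cs))
lemma6 []       cs _            5≤cs _     =
  selfPacking⇒specialPermutation (cycles-selfPacking 5≤cs)
lemma6 (p ∷ ps) cs (1≤p ∷ 1≤ps) 5≤cs short =
  selfPacking⇒specialPermutation (selfPacking-antimono (paths-≼-joinedPath p ps _)
    (path⊕-selfPacking (≤-trans 1≤p (≤-joinedLength p ps)) (cycles-selfPacking 5≤cs)
      (long-or-cycleVertex ps cs 1≤ps short)))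
  where
  long-or-cycleVertex : ∀ qs ds → All (1 ≤_) qs →
                        (∀ p′ → ds ≡ [] → p ∷ qs ≡ p′ ∷ [] → 3 ≤ p′) →
                        3 ≤ joinedLength p qs ⊎ Fin (order (⨁ (cycles ds)))
  long-or-cycleVertex (q ∷ qs) _ (1≤q ∷ _) _ =
    inj₁ (+-mono-≤ 1≤p (s≤s (≤-trans 1≤q (≤-joinedLength q qs))))
  long-or-cycleVertex [] []      _ short′ = inj₁ (short′ p refl refl)
  long-or-cycleVertex [] (_ ∷ _) _ _      = inj₂ zero
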